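{- Let $\succ$ be a complete strict social rule on $X$. Every u-local optimum of $\succ$ belongs to the maximal irreducible component $\mathcal T_{\max}$ of the tournament of $\succ$.
   Context: Fix $n\ge1$ and positive integers $m_1,\dots,m_n$; social outcomes are $n$-tuples $x$ with $0\le x_i<m_i$, forming $X$. A complete strict social rule $\succ$ on $X$: for distinct $x,y$ exactly one of $x\succ y$, $y\succ x$ (not necessarily transitive); view it as a tournament with an arc $x\to y$ ($x$ dominates $y$) when $x\succ y$. The irreducible components are the maximal sub-tournaments in which every two nodes lie on a common directed cycle; they partition $X$ and are indexed $\mathcal T_1,\dots,\mathcal T_r$ so that for $i>j$ every node of $\mathcal T_i$ dominates every node of $\mathcal T_j$; $\mathcal T_{\max}=\mathcal T_r$. An object is a nonempty $I\subseteq\{1,\dots,n\}$; an objects scheme is a finite set $A$ of objects with union $\{1,\dots,n\}$. $\Phi(x,I)=\{y: y\succ x,\ y_i=x_i\ \forall i\notin I\}$; $B(x,I)$ is the set of $y\in\Phi(x,I)$ with $y\succ w$ for all $w\in\Phi(x,I)\setminus\{y\}$. $x$ is a local optimum for $A$ if $\Phi(x,I)=\emptyset$ for all $I\in A$. A domination path through $A$ from $x$ to $y$ is a sequence $x=x_0,\dots,x_s=y$ ($s\ge0$) with, for each $i\ge1$, some $I\in A$ with $x_i\in B(x_{i-1},I)$. $\Psi(z,A)$ is the set of $x$ such that $z$ is a local optimum for $A$ and a domination path through $A$ from $x$ to $z$ exists; the universal basin is $\Psi(z)=\bigcup_A\Psi(z,A)$ over all objects schemes. $z$ is a u-local optimum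 if $\Psi(z)=X$. -}

module Defs where

open import Data.Nat using (ℕ; _≤_; _≥_)
open import Data.Fin using (Fin)
open import Data.Fin.Subset using (Subset; Nonempty) renaming (_∈_ to _∈ₛ_; _∉_ to _∉ₛ_)
open import Data.List using (List)
open import Data.List.Membership.Propositional using (_∈_)
open import Data.List.Relation.Unary.All using (All)
open import Data.Product using (Σ; ∃; _×_; _,_)
open import Data.Sum using (_⊎_)
open import Relation.Nullary using (¬_)
open import Relation.Binary.PropositionalEquality using (_≡_; _≢_)

Outcome : (n : ℕ) → (Fin n → ℕ) → Set
Outcome n m = (i : Fin n) → Fin (m i)

module Social {n : ℕ} {m : Fin n → ℕ} (_≻_ : Outcome n m → Outcome n m → Set) where

  X : Set
  X = Outcome n m

  -- complete strict social rule: for distinct x,y exactly one of x ≻ y, y ≻ x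
  -- (and, being strict, x ≻ x never holds; asymmetry gives this).
  IsCompleteStrict : Set
  IsCompleteStrict =
    (∀ x y → x ≢ y → (x ≻ y) ⊎ (y ≻ x)) × (∀ x y → x ≻ y → ¬ (y ≻ x))

  data Reach : X → X → Set where
    here  : ∀ {x} → Reach x x
    there : ∀ {x y z} → x ≻ y → Reach y z → Reach x z

  SameComp : X → X → Set
  SameComp x y = Reach x y × Reach y x

  -- z ∈ T_max: z's component is the one whose nodes dominate every node
  -- of every other component.
  InTmax : X → Set
  InTmax z = ∀ y → ¬ SameComp z y → z ≻ y

  Object : Set
  Object = Subset n

  IsScheme : List Object → Set
  IsScheme A = All Nonempty A × (∀ (i : Fin n) → ∃ λ I → I ∈ A × i ∈ₛ I)

  Φ : X → Object → X → Set
  Φ x I y = (y ≻ x) × (∀ i → i ∉ₛ I → y i ≡ x i)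

  B : X → Object → X → Set
  B x I y = Φ x I y × (∀ w → Φ x I w → w ≢ y → y ≻ w)

  LocalOpt : X → List Object → Set
  LocalOpt x A = ∀ I → I ∈ A → ∀ y → ¬ Φ x I y

  data DomPath (A : List Object) : X → X → Set where
    stop : ∀ {x} → DomPath A x x
    step : ∀ {x x₁ y} I → I ∈ A → B x I x₁ → DomPath A x₁ y → DomPath A x y

  ΨA : X → List Object → X → Set
  ΨA z A x = LocalOpt z A × DomPath A x z

  Ψ : X → X → Set
  Ψ z x = Σ (List Object) λ A → IsScheme A × ΨA z A x

  IsULocalOpt : X → Set
  IsULocalOpt z = ∀ x → Ψ z x

-- Each step of a domination path moves to an outcome dominating the previous one, so
-- reading the path backwards gives a directed path in the tournament. A u-local optimum z
-- is the endpoint of a domination path from every outcome, hence reaches every node of the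
-- tournament; a node outside its component that dominated z would then share its
-- component, so z dominates everything outside its own component.
module Submission where

open import Defs
open import Data.Nat using (ℕ; _≤_)
open import Data.Fin using (Fin)
open import Data.Product using (_,_)
open import Data.Sum using (_⊎_; inj₁; inj₂)
open import Relation.Nullary using (contradiction)
open import Relation.Binary.PropositionalEquality using (_≢_; refl)

module _ {n : ℕ} {m : Fin n → ℕ} {_≻_ : Outcome n m → Outcome n m → Set} where
  open Social _≻_

  Reach-snoc : ∀ {x y z} → Reach x y → y ≻ z → Reach x z
  Reach-snoc here        y≻z = there y≻z here
  Reach-snoc (there p q) y≻z = there p (Reach-snoc q y≻z)

  DomPath⇒Reach-reverse : ∀ {A x z} → DomPath A x z → Reach z x
  DomPath⇒Reach-reverse stop = here
  DomPath⇒Reach-reverse (step _ _ ((x₁≻x , _) , _) p) =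
    Reach-snoc (DomPath⇒Reach-reverse p) x₁≻x

  uLocalOpt⇒reachesAll : ∀ {z} → IsULocalOpt z → ∀ x → Reach z x
  uLocalOpt⇒reachesAll u x with u x
  ... | _ , _ , _ , path = DomPath⇒Reach-reverse path

  reachesAll⇒InTmax : (∀ x y → x ≢ y → (x ≻ y) ⊎ (y ≻ x)) →
                      ∀ {z} → (∀ x → Reach z x) → InTmax z
  reachesAll⇒InTmax total {z} reach y z≁y
    with total z y (λ { refl → z≁y (here , here) })
  ... | inj₁ z≻y = z≻y
  ... | inj₂ y≻z = contradiction (reach y , there y≻z here) z≁y

mainTheorem5 : (n : ℕ) → 1 ≤ n → (m : Fin n → ℕ) → (∀ i → 1 ≤ m i) →
    (_≻_ : Outcome n m → Outcome n m → Set) →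
    Social.IsCompleteStrict _≻_ →
    ∀ z → Social.IsULocalOpt _≻_ z → Social.InTmax _≻_ z
mainTheorem5 _ _ _ _ _≻_ (total , _) z u =
  reachesAll⇒InTmax total (uLocalOpt⇒reachesAll u)
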